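{- Let $P$ and $R$ be two increasing interval partitions of $\omega$. Then the ideals $\mathcal{ED}_P$ and $\mathcal{ED}_R$ are isomorphic, i.e., there is a bijection $g:\omega\to\omega$ such that for every $A\subseteq\omega$, $A\in\mathcal{ED}_R$ if and only if $g^{ -1}(A)\in\mathcal{ED}_P$.
   Context: An interval partition $P=\{P_n:n\in\omega\}$ is a partition of $\omega$ into finite consecutive intervals (listed in increasing order); it is increasing if $|P_n|<|P_{n+1}|$ for all $n$. A selector of $P$ is a set $A\subseteq\omega$ with $|A\cap P_n|=1$ for every $n$. $\mathcal{ED}_P$ is the ideal on $\omega$ generated by all selectors of $P$ (the sets contained in a finite union of selectors). -}

module Defs where

open import Level using (0ℓ)
open import Data.Nat using (ℕ; zero; suc; _≤_; _<_; _∸_)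
open import Data.Fin using (Fin)
open import Data.Product using (Σ; ∃; _×_; _,_)
open import Relation.Unary using (Pred; _⊆_)
open import Relation.Binary.PropositionalEquality using (_≡_)

Subset : Set₁
Subset = Pred ℕ 0ℓ

-- An interval partition of ω, given by the left endpoints of its intervals:
-- P_n = [ start n , start (suc n) ).  start 0 = 0 and start is strictly
-- increasing, so the intervals are nonempty, finite, consecutive, listed in
-- increasing order and cover ω.
record IntervalPartition : Set where
  field
    start      : ℕ → ℕ
    start-zero : start zero ≡ zero
    start-mono : ∀ n → start n < start (suc n)

open IntervalPartition public

_∈Piece_ : ℕ → IntervalPartition × ℕ → Set
k ∈Piece (P , n) = start P n ≤ k × k < start P (suc n)

size : IntervalPartition → ℕ → ℕ
size P n = start P (suc n) ∸ start P n

Increasing : IntervalPartition → Set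
Increasing P = ∀ n → size P n < size P (suc n)

IsSelector : IntervalPartition → Subset → Set
IsSelector P A =
  ∀ n → ∃ λ k → (k ∈Piece (P , n) × A k)
                × (∀ j → j ∈Piece (P , n) → A j → j ≡ k)

ED : IntervalPartition → Subset → Set₁
ED P A = Σ ℕ λ m → Σ (Fin m → Subset) λ S →
           (∀ i → IsSelector P (S i)) × (∀ k → A k → ∃ λ i → S i k)

{-# OPTIONS --safe #-}
-- Write a point of ω as (n , o), the o-th element of the n-th piece.  As the pieces
-- grow, n < |P n|, hence o < |P n| < |R (|P n|)|: sending (n , o) to (|P n| , o) read in
-- R is an injection of ω into ω, and (m , o) ↦ (|R m| , o) read in P is one back.  Both
-- strictly raise the piece index, so every backward chain is finite and the
-- Schröder–Bernstein bijection h is computable; h x is either the forward image of x or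
-- its preimage under the backward map.  So h sends P n into the two pieces R (|P n|) and
-- R m with |R m| = n, and h⁻¹ likewise.  Along such a bijection the preimage of a
-- selector picks, in each piece, at most the two points that are fixed functions of the
-- piece index, i.e. it lies in the union of two selectors; hence h and h⁻¹ preserve ED.
module Submission where

open import Defs
open import Data.Bool using (Bool; true; false; not)
open import Data.Bool.Properties using (not-injective; not-¬)
open import Data.Empty using (⊥-elim)
open import Data.Fin using (Fin; toℕ; fromℕ<; splitAt; _↑ˡ_; _↑ʳ_)
open import Data.Fin.Properties using (any?; toℕ-fromℕ<; splitAt-↑ˡ; splitAt-↑ʳ)
open import Data.Nat using (ℕ; zero; suc; _+_; _∸_; _≤_; _<_; z≤n; s≤s)
open import Data.Nat.Properties
open import Data.Product using (∃; ∃₂; _×_; _,_; proj₁; proj₂)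
open import Data.Sum as Sum using (_⊎_; inj₁; inj₂; [_,_]′)
open import Function using (_∘_; case_of_)
open import Function.Bundles using (_⤖_; _⇔_; _↔_; Bijection; mk⇔; mk↔ₛ′)
open import Function.Definitions using (Injective)
open import Function.Properties.Inverse using (↔⇒⤖)
open import Relation.Binary.Definitions using (tri<; tri≈; tri>)
open import Relation.Binary.PropositionalEquality
open import Relation.Nullary using (Dec; yes; no; ¬_)
open import Relation.Nullary.Decidable using (_×-dec_; map′)
open import Relation.Unary using (_⊆_; _∪_)

record DecInjection (A B : Set) : Set where
  field
    to        : A → B
    injective : Injective _≡_ _≡_ to
    image?    : ∀ b → Dec (∃ λ a → to a ≡ b)

open DecInjection

record RankedInjections (A B : Set) : Set where
  field
    rankᴬ  : A → ℕ
    rankᴮ  : B → ℕ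
    f      : DecInjection A B
    g      : DecInjection B A
    f-rank : ∀ a → rankᴬ a < rankᴮ (to f a)
    g-rank : ∀ b → rankᴮ b < rankᴬ (to g b)

open RankedInjections

swap : ∀ {A B : Set} → RankedInjections A B → RankedInjections B A
swap D = record
  { rankᴬ = rankᴮ D ; rankᴮ = rankᴬ D ; f = g D ; g = f D
  ; f-rank = g-rank D ; g-rank = f-rank D }

rootedWithin : ∀ {A B : Set} → RankedInjections A B → ℕ → A → Bool
rootedWithin D zero    a = true
rootedWithin D (suc k) a with image? (g D) a
... | yes (b , _) = not (rootedWithin (swap D) k b)
... | no _        = true

rootedWithin-fuel : ∀ {A B : Set} (D : RankedInjections A B) {k l} a →
  rankᴬ D a < k → rankᴬ D a < l → rootedWithin D k a ≡ rootedWithin D l a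
rootedWithin-fuel D {suc k} {suc l} a (s≤s a≤k) (s≤s a≤l) with image? (g D) a
... | no _ = refl
... | yes (b , gb≡a) =
  cong not (rootedWithin-fuel (swap D) b (<-≤-trans b<a a≤k) (<-≤-trans b<a a≤l))
  where
  b<a : rankᴮ D b < rankᴬ D a
  b<a = subst (rankᴮ D b <_) (cong (rankᴬ D) gb≡a) (g-rank D b)

-- rooted D a: the backward chain a, g⁻¹ a, f⁻¹ (g⁻¹ a), … ends in A.  Ranks
-- strictly decrease along the chain, so rank a + 1 steps always suffice.
rooted : ∀ {A B : Set} → RankedInjections A B → A → Bool
rooted D a = rootedWithin D (suc (rankᴬ D a)) a

rooted-image : ∀ {A B : Set} (D : RankedInjections A B) {a b} →
  to (g D) b ≡ a → rooted D a ≡ not (rooted (swap D) b)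
rooted-image D {a} {b} gb≡a with image? (g D) a
... | no ∄b = ⊥-elim (∄b (b , gb≡a))
... | yes (b′ , gb′≡a) with injective (g D) (trans gb′≡a (sym gb≡a))
...   | refl = cong not (rootedWithin-fuel (swap D) b b<a ≤-refl)
  where
  b<a : rankᴮ D b < rankᴬ D a
  b<a = subst (rankᴮ D b <_) (cong (rankᴬ D) gb≡a) (g-rank D b)

rooted-noImage : ∀ {A B : Set} (D : RankedInjections A B) {a} →
  ¬ (∃ λ b → to (g D) b ≡ a) → rooted D a ≡ true
rooted-noImage D {a} ∄b with image? (g D) a
... | yes img = ⊥-elim (∄b img)
... | no _    = refl

unrooted-preimage : ∀ {A B : Set} (D : RankedInjections A B) {a} →
  rooted D a ≡ false → ∃ λ b → to (g D) b ≡ a × rooted (swap D) b ≡ true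
unrooted-preimage D {a} r = case image? (g D) a of λ where
  (yes (b , gb≡a)) → b , gb≡a , not-injective (trans (sym (rooted-image D gb≡a)) r)
  (no ∄b)          → ⊥-elim (not-¬ (rooted-noImage D ∄b) r)

sb : ∀ {A B : Set} → RankedInjections A B → A → B
sb D a with image? (g D) a
... | no _ = to (f D) a
... | yes (b , _) with rooted (swap D) b
...   | true  = b
...   | false = to (f D) a

sb-noImage : ∀ {A B : Set} (D : RankedInjections A B) {a} →
  ¬ (∃ λ b → to (g D) b ≡ a) → sb D a ≡ to (f D) a
sb-noImage D {a} ∄b with image? (g D) a
... | yes img = ⊥-elim (∄b img)
... | no _    = refl

sb-image : ∀ {A B : Set} (D : RankedInjections A B) {a b} → to (g D) b ≡ a →
  (rooted (swap D) b ≡ true → sb D a ≡ b) × (rooted (swap D) b ≡ false → sb D a ≡ to (f D) a)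
sb-image D {a} {b} gb≡a with image? (g D) a
... | no ∄b = ⊥-elim (∄b (b , gb≡a))
... | yes (b′ , gb′≡a) with injective (g D) (trans gb′≡a (sym gb≡a))
...   | refl with rooted (swap D) b
...     | true  = (λ _ → refl) , λ ()
...     | false = (λ ()) , λ _ → refl

sb-rooted : ∀ {A B : Set} (D : RankedInjections A B) {a} →
  rooted D a ≡ true → sb D a ≡ to (f D) a
sb-rooted D {a} r = case image? (g D) a of λ where
  (yes (b , gb≡a)) → proj₂ (sb-image D gb≡a) (not-injective (trans (sym (rooted-image D gb≡a)) r))
  (no ∄b)          → sb-noImage D ∄b

sb-inverse : ∀ {A B : Set} (D : RankedInjections A B) a → sb (swap D) (sb D a) ≡ a
sb-inverse D a with rooted D a in r
... | true  = trans (cong (sb (swap D)) (sb-rooted D r)) (proj₁ (sb-image (swap D) refl) r)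
... | false =
  let b , gb≡a , rb = unrooted-preimage D r
  in trans (cong (sb (swap D)) (proj₁ (sb-image D gb≡a) rb)) (trans (sb-rooted (swap D) rb) gb≡a)

sb-cases : ∀ {A B : Set} (D : RankedInjections A B) a →
  sb D a ≡ to (f D) a ⊎ to (g D) (sb D a) ≡ a
sb-cases D a with rooted D a in r
... | true  = inj₁ (sb-rooted D r)
... | false =
  let b , gb≡a , rb = unrooted-preimage D r
  in inj₂ (trans (cong (to (g D)) (proj₁ (sb-image D gb≡a) rb)) gb≡a)

sb-↔ : ∀ {A B : Set} → RankedInjections A B → A ↔ B
sb-↔ D = mk↔ₛ′ (sb D) (sb (swap D)) (sb-inverse (swap D)) (sb-inverse D)

stepwise⇒mono-≤ : (s : ℕ → ℕ) → (∀ n → s n < s (suc n)) → ∀ {m n} → m ≤ n → s m ≤ s n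
stepwise⇒mono-≤ s step {n = zero}  z≤n = ≤-refl
stepwise⇒mono-≤ s step {n = suc n} m≤1+n with m≤n⇒m<n∨m≡n m≤1+n
... | inj₁ (s≤s m≤n) = ≤-trans (stepwise⇒mono-≤ s step m≤n) (<⇒≤ (step n))
... | inj₂ refl      = ≤-refl

stepwise⇒mono-< : (s : ℕ → ℕ) → (∀ n → s n < s (suc n)) → ∀ {m n} → m < n → s m < s n
stepwise⇒mono-< s step {m} m<n = <-≤-trans (step m) (stepwise⇒mono-≤ s step m<n)

module _ (X : IntervalPartition) where

  start-mono-≤ : ∀ {m n} → m ≤ n → start X m ≤ start X n
  start-mono-≤ = stepwise⇒mono-≤ (start X) (start-mono X)

  ∈Piece-unique : ∀ {x m n} → x ∈Piece (X , m) → x ∈Piece (X , n) → m ≡ n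
  ∈Piece-unique {x} {m} {n} (m≤x , x<m′) (n≤x , x<n′) with <-cmp m n
  ... | tri< m<n _ _ = ⊥-elim (<⇒≱ (<-≤-trans x<m′ (start-mono-≤ m<n)) n≤x)
  ... | tri≈ _ m≡n _ = m≡n
  ... | tri> _ _ n<m = ⊥-elim (<⇒≱ (<-≤-trans x<n′ (start-mono-≤ n<m)) m≤x)

  piece : ∀ x → ∃ λ n → x ∈Piece (X , n)
  piece zero = 0 , ≤-reflexive (start-zero X) , subst (_< start X 1) (start-zero X) (start-mono X 0)
  piece (suc x) with piece x
  ... | n , n≤x , x<n′ with suc x <? start X (suc n)
  ...   | yes 1+x<n′ = n , m≤n⇒m≤1+n n≤x , 1+x<n′
  ...   | no 1+x≮n′  = suc n , ≮⇒≥ 1+x≮n′ , subst (_< start X (2 + n)) n′≡1+x (start-mono X (suc n))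
    where
    n′≡1+x : start X (suc n) ≡ suc x
    n′≡1+x = ≤-antisym (≮⇒≥ 1+x≮n′) x<n′

  pieceOf : ℕ → ℕ
  pieceOf x = proj₁ (piece x)

  ∈pieceOf : ∀ x → x ∈Piece (X , pieceOf x)
  ∈pieceOf x = proj₂ (piece x)

  pieceOf-unique : ∀ {x n} → x ∈Piece (X , n) → pieceOf x ≡ n
  pieceOf-unique {x} = ∈Piece-unique (∈pieceOf x)

  offset : ℕ → ℕ
  offset x = x ∸ start X (pieceOf x)

  point : ℕ → ℕ → ℕ
  point n o = start X n + o

  point-∈Piece : ∀ {n o} → o < size X n → point n o ∈Piece (X , n)
  point-∈Piece {n} {o} o<size =
    m≤m+n (start X n) o ,
    subst (point n o <_) (m+[n∸m]≡n (<⇒≤ (start-mono X n))) (+-monoʳ-< (start X n) o<size)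

  pieceOf-point : ∀ {n o} → o < size X n → pieceOf (point n o) ≡ n
  pieceOf-point = pieceOf-unique ∘ point-∈Piece

  offset-point : ∀ {n o} → o < size X n → offset (point n o) ≡ o
  offset-point {n} {o} o<size rewrite pieceOf-point o<size = m+n∸m≡n (start X n) o

  point-pieceOf-offset : ∀ x → point (pieceOf x) (offset x) ≡ x
  point-pieceOf-offset x = m+[n∸m]≡n (proj₁ (∈pieceOf x))

  offset<size : ∀ x → offset x < size X (pieceOf x)
  offset<size x = ∸-monoˡ-< (proj₂ (∈pieceOf x)) (proj₁ (∈pieceOf x))

  pieceOf-offset-injective : ∀ {x y} → pieceOf x ≡ pieceOf y → offset x ≡ offset y → x ≡ y
  pieceOf-offset-injective {x} {y} p o = begin
    x                              ≡⟨ point-pieceOf-offset x ⟨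
    point (pieceOf x) (offset x)   ≡⟨ cong₂ point p o ⟩
    point (pieceOf y) (offset y)   ≡⟨ point-pieceOf-offset y ⟩
    y                              ∎
    where open ≡-Reasoning

  module _ (increasing : Increasing X) where

    n<size : ∀ n → n < size X n
    n<size zero    = m<n⇒0<n∸m (start-mono X 0)
    n<size (suc n) = <-≤-trans (s≤s (n<size n)) (increasing n)

    size-injective : Injective _≡_ _≡_ (size X)
    size-injective {m} {n} sm≡sn with <-cmp m n
    ... | tri< m<n _ _ = ⊥-elim (<-irrefl sm≡sn (stepwise⇒mono-< (size X) increasing m<n))
    ... | tri≈ _ m≡n _ = m≡n
    ... | tri> _ _ n<m = ⊥-elim (<-irrefl (sym sm≡sn) (stepwise⇒mono-< (size X) increasing n<m))

  -- The index of a piece of size n (junk value 0 if there is none).  Searching below n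
  -- suffices for increasing X, where m < size X m.
  size⁻¹ : ℕ → ℕ
  size⁻¹ n with any? {n = n} (λ i → size X (toℕ i) ≟ n)
  ... | yes (i , _) = toℕ i
  ... | no _        = 0

  size⁻¹-size : Increasing X → ∀ m → size⁻¹ (size X m) ≡ m
  size⁻¹-size increasing m with any? {n = size X m} (λ i → size X (toℕ i) ≟ size X m)
  ... | yes (i , e) = size-injective increasing e
  ... | no ∄i       = ⊥-elim (∄i (fromℕ< m<sm , cong (size X) (toℕ-fromℕ< m<sm)))
    where
    m<sm : m < size X m
    m<sm = n<size increasing m

shift : IntervalPartition → IntervalPartition → ℕ → ℕ
shift X Y x = point Y (size X (pieceOf X x)) (offset X x)

module _ (X Y : IntervalPartition) (increasingˣ : Increasing X) (increasingʸ : Increasing Y) where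

  shift-fits : ∀ x → offset X x < size Y (size X (pieceOf X x))
  shift-fits x = <-trans (offset<size X x) (n<size Y increasingʸ _)

  pieceOf-shift : ∀ x → pieceOf Y (shift X Y x) ≡ size X (pieceOf X x)
  pieceOf-shift x = pieceOf-point Y (shift-fits x)

  offset-shift : ∀ x → offset Y (shift X Y x) ≡ offset X x
  offset-shift x = offset-point Y (shift-fits x)

  shift-rank : ∀ x → pieceOf X x < pieceOf Y (shift X Y x)
  shift-rank x rewrite pieceOf-shift x = n<size X increasingˣ (pieceOf X x)

  shift-injective : Injective _≡_ _≡_ (shift X Y)
  shift-injective {x} {x′} sx≡sx′ = pieceOf-offset-injective X
    (size-injective X increasingˣ
      (trans (sym (pieceOf-shift x)) (trans (cong (pieceOf Y) sx≡sx′) (pieceOf-shift x′))))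
    (trans (sym (offset-shift x)) (trans (cong (offset Y) sx≡sx′) (offset-shift x′)))

  shift-image? : ∀ y → Dec (∃ λ x → shift X Y x ≡ y)
  shift-image? y = map′ preimage fits (size X n ≟ pieceOf Y y ×-dec offset Y y <? size X n)
    where
    n : ℕ
    n = size⁻¹ X (pieceOf Y y)

    preimage : size X n ≡ pieceOf Y y × offset Y y < size X n → ∃ λ x → shift X Y x ≡ y
    preimage (sn≡m , o<sn) = point X n (offset Y y) , (begin
      point Y (size X (pieceOf X (point X n (offset Y y)))) (offset X (point X n (offset Y y)))
        ≡⟨ cong₂ (point Y) (cong (size X) (pieceOf-point X o<sn)) (offset-point X o<sn) ⟩
      point Y (size X n) (offset Y y)
        ≡⟨ cong (λ m → point Y m (offset Y y)) sn≡m ⟩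
      point Y (pieceOf Y y) (offset Y y)
        ≡⟨ point-pieceOf-offset Y y ⟩
      y ∎)
      where open ≡-Reasoning

    fits : (∃ λ x → shift X Y x ≡ y) → size X n ≡ pieceOf Y y × offset Y y < size X n
    fits (x , refl) = sn≡m , o<sn
      where
      n≡pieceOf : n ≡ pieceOf X x
      n≡pieceOf = trans (cong (size⁻¹ X) (pieceOf-shift x)) (size⁻¹-size X increasingˣ _)

      sn≡m : size X n ≡ pieceOf Y (shift X Y x)
      sn≡m = trans (cong (size X) n≡pieceOf) (sym (pieceOf-shift x))

      o<sn : offset Y (shift X Y x) < size X n
      o<sn = subst₂ _<_ (sym (offset-shift x)) (cong (size X) (sym n≡pieceOf)) (offset<size X x)

  shiftInjection : DecInjection ℕ ℕ
  shiftInjection = record { to = shift X Y ; injective = shift-injective ; image? = shift-image? }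

shiftPair : (X Y : IntervalPartition) → Increasing X → Increasing Y → RankedInjections ℕ ℕ
shiftPair X Y increasingˣ increasingʸ = record
  { rankᴬ  = pieceOf X
  ; rankᴮ  = pieceOf Y
  ; f      = shiftInjection X Y increasingˣ increasingʸ
  ; g      = shiftInjection Y X increasingʸ increasingˣ
  ; f-rank = shift-rank X Y increasingˣ increasingʸ
  ; g-rank = shift-rank Y X increasingʸ increasingˣ
  }

IntoTwoPieces : IntervalPartition → IntervalPartition → (ℕ → ℕ) → Set
IntoTwoPieces X Y h =
  ∃₂ λ (d₁ d₂ : ℕ → ℕ) → ∀ x → pieceOf Y (h x) ≡ d₁ (pieceOf X x) ⊎ pieceOf Y (h x) ≡ d₂ (pieceOf X x)

sb-shiftPair-intoTwoPieces : (X Y : IntervalPartition)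
  (increasingˣ : Increasing X) (increasingʸ : Increasing Y) →
  IntoTwoPieces X Y (sb (shiftPair X Y increasingˣ increasingʸ))
sb-shiftPair-intoTwoPieces X Y increasingˣ increasingʸ =
  size X , size⁻¹ Y , λ x → Sum.map (viaShift x) (viaPreimage x) (sb-cases D x)
  where
  D : RankedInjections ℕ ℕ
  D = shiftPair X Y increasingˣ increasingʸ
  open ≡-Reasoning

  viaShift : ∀ x → sb D x ≡ shift X Y x → pieceOf Y (sb D x) ≡ size X (pieceOf X x)
  viaShift x e = trans (cong (pieceOf Y) e) (pieceOf-shift X Y increasingˣ increasingʸ x)

  viaPreimage : ∀ x → shift Y X (sb D x) ≡ x → pieceOf Y (sb D x) ≡ size⁻¹ Y (pieceOf X x)
  viaPreimage x e = begin
    pieceOf Y (sb D x)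
      ≡⟨ size⁻¹-size Y increasingʸ _ ⟨
    size⁻¹ Y (size Y (pieceOf Y (sb D x)))
      ≡⟨ cong (size⁻¹ Y) (pieceOf-shift Y X increasingʸ increasingˣ (sb D x)) ⟨
    size⁻¹ Y (pieceOf X (shift Y X (sb D x)))
      ≡⟨ cong (size⁻¹ Y ∘ pieceOf X) e ⟩
    size⁻¹ Y (pieceOf X x) ∎

_∈Piece?_ : ∀ x Xn → Dec (x ∈Piece Xn)
x ∈Piece? (X , n) = start X n ≤? x ×-dec x <? start X (suc n)

selectedBy : IntervalPartition → (ℕ → ℕ) → Subset
selectedBy X ψ x = x ≡ ψ (pieceOf X x)

choice : (Y : IntervalPartition) {S : Subset} → IsSelector Y S → ℕ → ℕ
choice Y s n = proj₁ (s n)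

selector⊆selectedBy : (Y : IntervalPartition) {S : Subset} (s : IsSelector Y S) →
  S ⊆ selectedBy Y (choice Y s)
selector⊆selectedBy Y s {y} y∈S = proj₂ (proj₂ (s (pieceOf Y y))) y (∈pieceOf Y y) y∈S

module _ (X : IntervalPartition) where

  clamp : (ℕ → ℕ) → ℕ → ℕ
  clamp ψ n with ψ n ∈Piece? (X , n)
  ... | yes _ = ψ n
  ... | no _  = start X n

  clamp-∈Piece : ∀ ψ n → clamp ψ n ∈Piece (X , n)
  clamp-∈Piece ψ n with ψ n ∈Piece? (X , n)
  ... | yes ψn∈ = ψn∈
  ... | no _    = ≤-refl , start-mono X n

  clamp-id : ∀ ψ n → ψ n ∈Piece (X , n) → clamp ψ n ≡ ψ n
  clamp-id ψ n ψn∈ with ψ n ∈Piece? (X , n)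
  ... | yes _   = refl
  ... | no ψn∉ = ⊥-elim (ψn∉ ψn∈)

  selectedBy-clamp-isSelector : ∀ ψ → IsSelector X (selectedBy X (clamp ψ))
  selectedBy-clamp-isSelector ψ n =
    clamp ψ n ,
    (clamp-∈Piece ψ n , cong (clamp ψ) (sym (pieceOf-unique X (clamp-∈Piece ψ n)))) ,
    λ j j∈Pₙ j≡ → trans j≡ (cong (clamp ψ) (pieceOf-unique X j∈Pₙ))

  selectedBy⊆selectedBy-clamp : ∀ ψ → selectedBy X ψ ⊆ selectedBy X (clamp ψ)
  selectedBy⊆selectedBy-clamp ψ {x} x≡ =
    trans x≡ (sym (clamp-id ψ (pieceOf X x) (subst (_∈Piece (X , pieceOf X x)) x≡ (∈pieceOf X x))))

  ED-⊆ : {A B : Subset} → A ⊆ B → ED X B → ED X A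
  ED-⊆ A⊆B (m , S , selectors , cover) = m , S , selectors , λ k k∈A → cover k (A⊆B k∈A)

  ED-∪ : {A B : Subset} → ED X A → ED X B → ED X (A ∪ B)
  ED-∪ {A} {B} (m , S , selectorsˢ , coverᴬ) (n , T , selectorsᵀ , coverᴮ) =
    m + n , [ S , T ]′ ∘ splitAt m , selectors , cover
    where
    selectors : ∀ j → IsSelector X ([ S , T ]′ (splitAt m j))
    selectors j with splitAt m j
    ... | inj₁ i = selectorsˢ i
    ... | inj₂ i = selectorsᵀ i

    cover : ∀ k → (A ∪ B) k → ∃ λ j → [ S , T ]′ (splitAt m j) k
    cover k (inj₁ k∈A) =
      let i , k∈Sᵢ = coverᴬ k k∈A
      in i ↑ˡ n , subst (λ z → [ S , T ]′ z k) (sym (splitAt-↑ˡ m i n)) k∈Sᵢ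
    cover k (inj₂ k∈B) =
      let i , k∈Tᵢ = coverᴮ k k∈B
      in m ↑ʳ i , subst (λ z → [ S , T ]′ z k) (sym (splitAt-↑ʳ m n i)) k∈Tᵢ

  ED-selectedBy : ∀ {m} (ψ : Fin m → ℕ → ℕ) → ED X (λ x → ∃ λ i → selectedBy X (ψ i) x)
  ED-selectedBy {m} ψ =
    m , (λ i → selectedBy X (clamp (ψ i))) , (λ i → selectedBy-clamp-isSelector (ψ i)) ,
    λ k (i , k∈) → i , selectedBy⊆selectedBy-clamp (ψ i) k∈

ED-preimage : (X Y : IntervalPartition) (h h⁻¹ : ℕ → ℕ) → (∀ x → h⁻¹ (h x) ≡ x) →
  IntoTwoPieces X Y h → {A : Subset} → ED Y A → ED X (A ∘ h)
ED-preimage X Y h h⁻¹ h⁻¹∘h (d₁ , d₂ , intoTwo) {A} (m , S , selectors , cover) =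
  ED-⊆ X covered (ED-∪ X (ED-selectedBy X (ψ d₁)) (ED-selectedBy X (ψ d₂)))
  where
  ψ : (ℕ → ℕ) → Fin m → ℕ → ℕ
  ψ d i = h⁻¹ ∘ choice Y (selectors i) ∘ d

  pullBack : ∀ {x} i d → S i (h x) → pieceOf Y (h x) ≡ d (pieceOf X x) → selectedBy X (ψ d i) x
  pullBack {x} i d hx∈Sᵢ e = begin
    x                                              ≡⟨ h⁻¹∘h x ⟨
    h⁻¹ (h x)                                      ≡⟨ cong h⁻¹ (selector⊆selectedBy Y (selectors i) hx∈Sᵢ) ⟩
    h⁻¹ (choice Y (selectors i) (pieceOf Y (h x))) ≡⟨ cong (h⁻¹ ∘ choice Y (selectors i)) e ⟩
    ψ d i (pieceOf X x)                            ∎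
    where open ≡-Reasoning

  covered : A ∘ h ⊆ (λ x → ∃ λ i → selectedBy X (ψ d₁ i) x) ∪
                     (λ x → ∃ λ i → selectedBy X (ψ d₂ i) x)
  covered {x} hx∈A =
    let i , hx∈Sᵢ = cover (h x) hx∈A
    in Sum.map (λ e → i , pullBack i d₁ hx∈Sᵢ e) (λ e → i , pullBack i d₂ hx∈Sᵢ e) (intoTwo x)

ED-preimage-⇔ : (X Y : IntervalPartition) (h h⁻¹ : ℕ → ℕ) →
  (∀ x → h⁻¹ (h x) ≡ x) → (∀ y → h (h⁻¹ y) ≡ y) →
  IntoTwoPieces X Y h → IntoTwoPieces Y X h⁻¹ → (A : Subset) → ED Y A ⇔ ED X (A ∘ h)
ED-preimage-⇔ X Y h h⁻¹ h⁻¹∘h h∘h⁻¹ hIntoTwo h⁻¹IntoTwo A = mk⇔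
  (ED-preimage X Y h h⁻¹ h⁻¹∘h hIntoTwo)
  (ED-⊆ Y (λ {y} → subst A (sym (h∘h⁻¹ y))) ∘ ED-preimage Y X h⁻¹ h h∘h⁻¹ h⁻¹IntoTwo)

mainTheorem9 : (P R : IntervalPartition) → Increasing P → Increasing R →
    ∃ λ (g : ℕ ⤖ ℕ) → (A : Subset) →
    ED R A ⇔ ED P (λ k → A (Bijection.to g k))
mainTheorem9 P R increasingᴾ increasingᴿ =
  ↔⇒⤖ (sb-↔ D) ,
  ED-preimage-⇔ P R (sb D) (sb (swap D)) (sb-inverse D) (sb-inverse (swap D))
    (sb-shiftPair-intoTwoPieces P R increasingᴾ increasingᴿ)
    (sb-shiftPair-intoTwoPieces R P increasingᴿ increasingᴾ)
  where
  D : RankedInjections ℕ ℕ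
  D = shiftPair P R increasingᴾ increasingᴿ
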